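{- Let $\mathcal I=\mathcal I_1\|\cdots\|\mathcal I_n$ be a closed IOSA, let $v,v'\in V$ be vertices of its enabled graph $\mathsf{EG}_{\mathcal I}=(V,E)$, and let $\rho$ be a path following $E$ from $v$ to $v'$. Then for every $b\in v'$ there is an action $a\in v$ such that $a\leadsto^*b$.
   Context: An IOSA is a tuple $\mathcal I=(\mathcal S,\mathcal A,\mathcal C,\rightarrow,C_0,s_0)$: denumerable states $\mathcal S$; denumerable actions $\mathcal A$ partitioned into inputs $\mathcal A^{\mathsf i}$ and outputs $\mathcal A^{\mathsf o}$, with urgent subset $\mathcal A^{\mathsf u}$ and silent action $\tau\in\mathcal A^{\mathsf u}\cap\mathcal A^{\mathsf o}$; finite clock set $\mathcal C$; transitions $s\xrightarrow{C,a,C'}s'$ with $C,C'\subseteq\mathcal C$; initial state $s_0$; subject to the IOSA well-formedness conditions (urgent and input transitions have empty guard clock set, non-urgent outputs have a singleton guard, determinism of clock-guarded outputs, input enabledness and determinism, existence of an active-clock function). Closed means $\mathcal A^{\mathsf i}=\emptyset$. $\mathcal I=\mathcal I_1\|\cdots\|\mathcal I_n$ is the parallel composition of pairwise compatible IOSAs (compatible: no shared non-$\tau$ outputs, disjoint clocks, $\mathcal A_1\cap\mathcal A^{\mathsf u}_2=\mathcal A_2\cap\mathcal A^{\mathsf u}_1$), where transitions of a binary composition are interleaved on non-shared actions and $\tau$, and synchronized (union of guard and reset clock sets) on shared non-$\tau$ actions; states are tuples $s_1\|\cdots\|s_n$. $\mathrm{uen}(s)=\{a\in\mathcal A^{\mathsf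 u}\mid s\xrightarrow{\_,a,\_}\_\}$. A state $s$ is stable if no $a\in\mathcal A^{\mathsf u}\cap\mathcal A^{\mathsf o}$ has $s\xrightarrow{\emptyset,a,\_}\_$. A state is potentially reachable if reachable from the initial state by a path $s_0\xrightarrow{\_,a_0,\_}s_1\cdots$ such that whenever $s_i$ enables some action in $\mathcal A^{\mathsf u}\cap\mathcal A^{\mathsf o}$, $a_i\in\mathcal A^{\mathsf u}$. $B\subseteq\mathcal A^{\mathsf u}\cap\mathcal A^{\mathsf o}$ is spontaneously enabled by $a\in\mathcal A\setminus\mathcal A^{\mathsf u}$ in $\mathcal I$ if $B=\emptyset$ or there are potentially reachable $s,s'$ with $s$ stable, $s\xrightarrow{\_,a,\_}s'$, $B\subseteq\mathrm{uen}(s')$; maximal if no strictly larger such set exists. For $a\in\mathcal A^{\mathsf u}$, $b\in\mathcal A^{\mathsf u}\cap\mathcal A^{\mathsf o}$, $a$ triggers $b$ in $\mathcal I$ if there are potentially reachable $s_1,s_2,s_3$ with $s_1\xrightarrow{\_,a,\_}s_2\xrightarrow{\_,b,\_}s_3$ and, if $a\ne b$, $b\notin\mathrm{uen}(s_1)$. ${\leadsto}=\bigcup_{i=1}^n\{(a,b)\mid a\text{ triggers }b\text{ in }\mathcal I_i\}$; $\leadsto^*$ is its reflexive transitive closure. The enabled graph $\mathsf{EG}_{\mathcal I}=(V,E)$ has $V=\bigcup_{k\ge0}V_k$, $E=\bigcup_{k\ge0}E_k$ with $V_0=\bigcup_{a\in\mathcal A}\{\bigcup_{i=1}^nB_i\mid\text{for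 all }i,\ B_i\text{ spontaneously enabled by }a\text{ and maximal in }\mathcal I_i\}\cup\{\bigcup_{i=1}^n(\mathrm{uen}(s^0_i)\cap\mathcal A^{\mathsf o}_i)\}$ ($s^0_i$ initial state of $\mathcal I_i$), $E_k=\{(v,a,(v\setminus\{a\})\cup\{b\mid a\leadsto b\})\mid v\in V_k,a\in v\}$, $V_{k+1}=\{v'\mid v\in V_k,(v,\_,v')\in E_k,v'\notin\bigcup_{j\le k}V_j\}$. A path following $E$ is a sequence of edges $(v_0,c_0,v_1),(v_1,c_1,v_2),\dots$ in $E$. -}

module Defs where

open import Level using (0ℓ)
open import Data.Nat using (ℕ; zero; suc)
open import Data.Fin using (Fin)
open import Data.Product using (Σ; ∃; ∃-syntax; _×_; _,_)
open import Data.Sum using (_⊎_)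
open import Relation.Nullary using (¬_)
import Data.Empty
open import Relation.Binary.PropositionalEquality using (_≡_; _≢_)
open import Relation.Unary using (Pred; _∈_; _∉_; _⊆_; _≐_; _∩_; _∪_)
open import Relation.Binary.Construct.Closure.ReflexiveTransitive using (Star)
import Data.Fin.Subset as FS
open import Function.Bundles using (_↣_)

ASet : Set → Set₁
ASet Act = Pred Act 0ℓ

-- Act is the global (denumerable) action universe, τ the silent action.

record IOSA (Act : Set) (τ : Act) : Set₁ where
  field
    State   : Set
    stateDenumerable : State ↣ ℕ
    A       : ASet Act
    Ai      : ASet Act
    Ao      : ASet Act
    Au      : ASet Act
    nClk    : ℕ
    Trans   : State → FS.Subset nClk → Act → FS.Subset nClk → State → Set
    C₀      : FS.Subset nClk
    s₀      : State

    io-cover    : A ≐ (Ai ∪ Ao)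
    io-disjoint : ∀ a → a ∈ Ai → a ∈ Ao → Data.Empty.⊥
    urgent⊆A    : Au ⊆ A
    τ-urgent    : τ ∈ Au
    τ-output    : τ ∈ Ao
    trans-act   : ∀ {s C a C' s'} → Trans s C a C' s' → a ∈ A

  enabling : State → FS.Subset nClk → Set
  enabling s X = ∀ x → (∃[ C ] ∃[ a ] ∃[ C' ] ∃[ s' ] (Trans s C a C' s' × x FS.∈ C)) → x FS.∈ X

  stable : State → Set
  stable s = ∀ a → a ∈ Au → a ∈ Ao → ∀ C' s' → ¬ Trans s FS.⊥ a C' s'

  field
    wf-a : ∀ {s C a C' s'} → Trans s C a C' s' → (a ∈ Ai ⊎ a ∈ Au) → C ≡ FS.⊥
    wf-b : ∀ {s C a C' s'} → Trans s C a C' s' → a ∈ Ao → a ∉ Au → ∃[ x ] C ≡ FS.⁅ x ⁆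
    wf-c : ∀ {s x a₁ a₂ C₁ C₂ s₁ s₂} →
           Trans s FS.⁅ x ⁆ a₁ C₁ s₁ → Trans s FS.⁅ x ⁆ a₂ C₂ s₂ →
           a₁ ≡ a₂ × C₁ ≡ C₂ × s₁ ≡ s₂
    wf-d : ∀ s a → a ∈ Ai → ∃[ C' ] ∃[ s' ] Trans s FS.⊥ a C' s'
    wf-e : ∀ {s a C₁ C₂ s₁ s₂} → a ∈ Ai →
           Trans s FS.⊥ a C₁ s₁ → Trans s FS.⊥ a C₂ s₂ → C₁ ≡ C₂ × s₁ ≡ s₂
    wf-f : Σ (State → FS.Subset nClk) λ active →
             (active s₀ FS.⊆ C₀)
           × (∀ s → enabling s (active s))
           × (∀ s → stable s → ∀ x → x FS.∈ active s →
                ∃[ C ] ∃[ a ] ∃[ C' ] ∃[ s' ] (Trans s C a C' s' × x FS.∈ C))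
           × (∀ {s C a C' s'} → Trans s C a C' s' →
                active s' FS.⊆ ((active s FS.─ C) FS.∪ C'))

  uen : State → ASet Act
  uen s a = a ∈ Au × ∃[ C ] ∃[ C' ] ∃[ s' ] Trans s C a C' s'

  enablesUrgentOutput : State → Set
  enablesUrgentOutput s = ∃[ b ] (b ∈ Au × b ∈ Ao × ∃[ C ] ∃[ C' ] ∃[ s' ] Trans s C b C' s')

  data PotReach : State → Set where
    init : PotReach s₀
    step : ∀ {s C a C' s'} → PotReach s → Trans s C a C' s' →
           (enablesUrgentOutput s → a ∈ Au) → PotReach s'

  -- B is spontaneously enabled by a (a ∈ A ∖ Aᵘ is imposed where used)
  SpontEnabled : Act → ASet Act → Set
  SpontEnabled a B =
      (B ⊆ (Au ∩ Ao))
    × ((∀ b → b ∉ B)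
       ⊎ ∃[ s ] ∃[ s' ] (PotReach s × PotReach s' × stable s
                         × ∃[ C ] ∃[ C' ] Trans s C a C' s' × B ⊆ uen s'))

  MaximalSpontEnabled : Act → ASet Act → Set₁
  MaximalSpontEnabled a B =
    SpontEnabled a B ×
    (∀ (B' : ASet Act) → SpontEnabled a B' → ¬ (B ⊆ B' × ¬ (B' ⊆ B)))

  Triggers : Act → Act → Set
  Triggers a b =
    a ∈ Au × b ∈ Au × b ∈ Ao ×
    ∃[ s₁ ] ∃[ s₂ ] ∃[ s₃ ] (PotReach s₁ × PotReach s₂ × PotReach s₃
      × ∃[ C₁ ] ∃[ C₁' ] Trans s₁ C₁ a C₁' s₂
      × ∃[ C₂ ] ∃[ C₂' ] Trans s₂ C₂ b C₂' s₃
      × (a ≢ b → b ∉ uen s₁))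

open IOSA public

module Composition {Act : Set} {τ : Act} {n : ℕ} (I : Fin n → IOSA Act τ) where

  -- pairwise compatibility (clock sets are disjoint by construction:
  -- the clocks of component i are the type Fin (nClk (I i)))
  Compatible : Set
  Compatible = ∀ (i j : Fin n) → i ≢ j →
      (∀ a → a ∈ Ao (I i) → a ∈ Ao (I j) → a ≡ τ)
    × (∀ a → (a ∈ A (I i) × a ∈ Au (I j)) → (a ∈ A (I j) × a ∈ Au (I i)))

  Acts : ASet Act
  Acts a = ∃[ i ] a ∈ A (I i)

  Outs : ASet Act
  Outs a = ∃[ i ] a ∈ Ao (I i)

  Ins : ASet Act
  Ins a = (∃[ i ] a ∈ Ai (I i)) × a ∉ Outs

  Urg : ASet Act
  Urg a = ∃[ i ] a ∈ Au (I i)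

  Closed : Set
  Closed = ∀ a → a ∉ Ins

  _⇝_ : Act → Act → Set
  a ⇝ b = ∃[ i ] Triggers (I i) a b

  _⇝*_ : Act → Act → Set
  _⇝*_ = Star _⇝_

  -- Enabled graph EG = (V, E); vertices are sets of actions,
  -- membership in V_k is up to extensional set equality ≐.

  ⋃ : (Fin n → ASet Act) → ASet Act
  ⋃ B a = ∃[ i ] a ∈ B i

  InV₀ : ASet Act → Set₁
  InV₀ w =
      (∃[ a ] (a ∈ Acts × a ∉ Urg ×
         Σ (Fin n → ASet Act) λ B →
           (∀ i → MaximalSpontEnabled (I i) a (B i)) × w ≐ ⋃ B))
    ⊎ (w ≐ ⋃ (λ i b → uen (I i) (s₀ (I i)) b × b ∈ Ao (I i)))

  next : ASet Act → Act → ASet Act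
  next v a b = (b ∈ v × b ≢ a) ⊎ (a ⇝ b)

  mutual
    InV : ℕ → ASet Act → Set₁
    InV zero    w = InV₀ w
    InV (suc k) w =
      Σ (ASet Act) λ v → InV k v × ∃[ a ] (a ∈ v × w ≐ next v a) × ¬ InVUpTo k w

    InVUpTo : ℕ → ASet Act → Set₁
    InVUpTo zero    w = InV zero w
    InVUpTo (suc k) w = InVUpTo k w ⊎ InV (suc k) w

  InVert : ASet Act → Set₁
  InVert w = ∃[ k ] InV k w

  InE : ASet Act → Act → ASet Act → Set₁
  InE v a w = ∃[ k ] (InV k v × a ∈ v × w ≐ next v a)

  data PathE : ASet Act → ASet Act → Set₁ where
    []  : ∀ {v} → PathE v v
    _∷_ : ∀ {v a w v'} → InE v a w → PathE w v' → PathE v v'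

module Submission where

open import Defs
open import Data.Nat using (ℕ)
open import Data.Fin using (Fin)
open import Data.Product using (∃-syntax; _×_; _,_)
open import Data.Sum using (inj₁; inj₂)
open import Relation.Unary using (_∈_)
open import Function.Bundles using (_↣_)
open import Relation.Binary.Construct.Closure.ReflexiveTransitive using (ε; _◅_; _◅◅_)

module _ {Act : Set} {τ : Act} {n : ℕ} (I : Fin n → IOSA Act τ) where
  open Composition I

  next-reachable : ∀ {v a} → a ∈ v → ∀ c → c ∈ next v a → ∃[ d ] (d ∈ v × d ⇝* c)
  next-reachable           a∈v c (inj₁ (c∈v , _)) = c , c∈v , ε
  next-reachable {a = a} a∈v c (inj₂ a⇝c)       = a , a∈v , a⇝c ◅ ε

  InE-reachable : ∀ {v a w} → InE v a w → ∀ c → c ∈ w → ∃[ d ] (d ∈ v × d ⇝* c)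
  InE-reachable (_ , _ , a∈v , w⊆next , _) c c∈w = next-reachable a∈v c (w⊆next c∈w)

  PathE-reachable : ∀ {v v'} → PathE v v' → ∀ b → b ∈ v' → ∃[ a ] (a ∈ v × a ⇝* b)
  PathE-reachable []      b b∈v' = b , b∈v' , ε
  PathE-reachable (e ∷ p) b b∈v' with PathE-reachable p b b∈v'
  ... | c , c∈w , c⇝*b with InE-reachable e c c∈w
  ...   | a , a∈v , a⇝*c = a , a∈v , a⇝*c ◅◅ c⇝*b

lemma7 : {Act : Set} {τ : Act} → (Act ↣ ℕ) →
         (n : ℕ) (I : Fin n → IOSA Act τ) →
         Composition.Compatible I → Composition.Closed I →
         ∀ (v v' : ASet Act) → Composition.InVert I v → Composition.InVert I v' →
         Composition.PathE I v v' →
         ∀ b → b ∈ v' → ∃[ a ] (a ∈ v × Composition._⇝*_ I a b)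
lemma7 _ _ I _ _ _ _ _ _ ρ = PathE-reachable I ρ
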